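{- Let $d\geq 1$, $i\geq 0$, $I=[i,i+d-1]$ and $J=\{j_1,\ldots,j_d\}$ with $0\leq j_1<\cdots<j_d$, and suppose $J\leq I$. (a) $b^I_J=\pi^I_J\cdot b^{[i-j_1,\,i-j_1+d-2]}_{\{j_2-j_1-1,\ldots,j_d-j_1-1\}}$. (b) If $j_1=0$, then $b^I_J=b^{[i,i+d-2]}_{\{j_2-1,\ldots,j_d-1\}}$. (c) If $J=[0,d-1]$, then $b^I_J=1$ and $\pi^I_J=1$.
   Context: For integers $p,q\geq 0$, $b_{p,q}=\binom{p}{q}$, with $b_{p,q}=0$ if $q>p$. For $k\leq l$, $[k,l]=\{k,\ldots,l\}$; $[k,l]=\emptyset$ if $k>l$. For finite sets $I=\{i_1<\cdots<i_d\}$, $J=\{j_1<\cdots<j_d\}$ of non-negative integers, $b^I_J$ is the determinant of the $d\times d$ matrix with $(r,s)$ entry $b_{i_r,j_s}$ (the empty determinant is $1$). $J\leq I$ means $j_k\leq i_k$ for all $k$. When $J\leq I$, $\pi^I_J=\frac{b_{i_1,j_1}\cdots b_{i_d,j_1}}{b_{j_1,j_1}\cdots b_{j_d,j_1}}$. -}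

module Defs where

open import Data.Nat using (ℕ; zero; suc)
import Data.Nat as ℕ
open import Data.Nat.Combinatorics using (_C_)
open import Data.Fin using (Fin; zero; suc; toℕ; punchIn)
open import Data.Integer using (ℤ; +_; -_)
import Data.Integer as ℤ
open import Data.Rational using (ℚ; _/_; 0ℚ)

-- b_{p,q} = binom(p,q); stdlib's _C_ returns 0 when q > p.
b : ℕ → ℕ → ℕ
b p q = p C q

sumℤ : ∀ n → (Fin n → ℤ) → ℤ
sumℤ zero    f = + 0
sumℤ (suc n) f = f zero ℤ.+ sumℤ n (λ k → f (suc k))

prodℕ : ∀ n → (Fin n → ℕ) → ℕ
prodℕ zero    f = 1
prodℕ (suc n) f = f zero ℕ.* prodℕ n (λ k → f (suc k))

sgn : ℕ → ℤ
sgn zero          = + 1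
sgn (suc zero)    = - (+ 1)
sgn (suc (suc k)) = sgn k

det : ∀ n → (Fin n → Fin n → ℤ) → ℤ
det zero    M = + 1
det (suc n) M =
  sumℤ (suc n) (λ k → sgn (toℕ k) ℤ.* M zero k ℤ.* det n (λ r s → M (suc r) (punchIn k s)))

-- b^I_J for I = {I 0 < ... < I (d-1)}, J = {J 0 < ... < J (d-1)} given as
-- increasing functions Fin d → ℕ: determinant of (b_{i_r, j_s})_{r,s}.
bdet : ∀ d → (Fin d → ℕ) → (Fin d → ℕ) → ℤ
bdet d I J = det d (λ r s → + b (I r) (J s))

-- total division ℤ / ℕ into ℚ (value 0 if the denominator is 0; never used
-- in that case under the hypotheses J ≤ I)
_/'_ : ℤ → ℕ → ℚ
n /' zero  = 0ℚ
n /' suc k = n / suc k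

piIJ : ∀ e → (Fin (suc e) → ℕ) → (Fin (suc e) → ℕ) → ℚ
piIJ e I J =
  (+ prodℕ (suc e) (λ r → b (I r) (J zero))) /' prodℕ (suc e) (λ s → b (J s) (J zero))

toℚ : ℤ → ℚ
toℚ z = z / 1

interval : ∀ d → ℕ → Fin d → ℕ
interval d k r = k ℕ.+ toℕ r

module Submission where

-- Scaling column s by b(j_s, j_1) and using b(i+r, j_s) b(j_s, j_1) = b(i+r, j_1) b(i+r-j_1, j_s-j_1),
-- then pulling b(i+r, j_1) out of row r, gives
--   (∏_s b(j_s, j_1)) b^I_J = (∏_r b(i+r, j_1)) b^{[i-j_1, i-j_1+d-1]}_{J-j_1},
-- which is (a) once the right-hand determinant, whose first column index is 0, is reduced by (b).
-- For (b), replacing every row but the first by its difference with the row above turns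
-- b(m+r, j) into b(m+r-1, j-1) by Pascal's rule and the first column into (1, 0, ..., 0);
-- expanding along that column deletes the first row and column. (c) is (b) iterated,
-- and π = 1 because b(x, 0) = 1.

open import Defs
open import Data.Nat as ℕ using (ℕ; zero; suc; _≤_; _<_; _>_; z≤n; s≤s; _∸_)
import Data.Nat.Properties as ℕP
open import Data.Nat.Combinatorics using (_C_; nC1≡n; k>n⇒nCk≡0; nCk+nC[k+1]≡[n+1]C[k+1])
open import Data.Fin as Fin using (Fin; zero; suc; toℕ; punchIn; punchOut)
import Data.Fin.Properties as FinP
open import Data.Vec.Functional using (Vector; _∷_)
open import Data.Integer as ℤ using (ℤ; +_; -_; -[1+_]; -1ℤ)
import Data.Integer.Properties as ℤP
import Data.Rational as ℚ
open import Data.Rational.Properties using (toℚᵘ-injective; toℚᵘ-fromℚᵘ; toℚᵘ-homo-*)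
import Data.Rational.Unnormalised as ℚᵘ
import Data.Rational.Unnormalised.Properties as ℚᵘP
import Algebra.Properties.CommutativeMonoid.Sum ℕP.*-1-commutativeMonoid as Product
open import Data.Product using (_×_; _,_)
open import Function using (_∘_)
open import Relation.Binary.PropositionalEquality
open import Relation.Nullary using (yes; no; contradiction)

prodℕ≡product : ∀ n (f : Fin n → ℕ) → prodℕ n f ≡ Product.sum f
prodℕ≡product zero    f = refl
prodℕ≡product (suc n) f = cong (f zero ℕ.*_) (prodℕ≡product n (f ∘ suc))

prodℕ-pos : ∀ n (f : Fin n → ℕ) → (∀ k → f k > 0) → prodℕ n f > 0
prodℕ-pos zero    f pos = s≤s z≤n
prodℕ-pos (suc n) f pos = ℕP.*-mono-≤ (pos zero) (prodℕ-pos n (f ∘ suc) (pos ∘ suc))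

prodℕ-ones : ∀ n → prodℕ n (λ _ → 1) ≡ 1
prodℕ-ones n = trans (prodℕ≡product n _) (Product.sum-replicate-zero n)

piIJ-head-zero : ∀ e (I J : Fin (suc e) → ℕ) → J zero ≡ 0 → piIJ e I J ≡ ℚ.1ℚ
piIJ-head-zero e I J J₀≡0 = cong₂ (λ p q → (+ p) /' q) (ones I) (ones J)
  where
  ones : (K : Fin (suc e) → ℕ) → prodℕ (suc e) (λ r → b (K r) (J zero)) ≡ 1
  ones K = trans (cong (λ k → prodℕ (suc e) (λ r → b (K r) k)) J₀≡0) (prodℕ-ones (suc e))

q*x≡p*y⇒x≡p/q*y : ∀ x y p q → q > 0 → + q ℤ.* x ≡ + p ℤ.* y → toℚ x ≡ ((+ p) /' q) ℚ.* toℚ y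
q*x≡p*y⇒x≡p/q*y x y p (suc q) _ qx≡py = toℚᵘ-injective (begin
  ℚ.toℚᵘ (toℚ x)                                  ≈⟨ toℚᵘ-fromℚᵘ (ℚᵘ.mkℚᵘ x 0) ⟩
  ℚᵘ.mkℚᵘ x 0                                     ≈⟨ ℚᵘ.*≡* cross ⟩
  ℚᵘ.mkℚᵘ (+ p) q ℚᵘ.* ℚᵘ.mkℚᵘ y 0               ≈⟨ ℚᵘP.*-cong (toℚᵘ-fromℚᵘ (ℚᵘ.mkℚᵘ (+ p) q))
                                                                 (toℚᵘ-fromℚᵘ (ℚᵘ.mkℚᵘ y 0)) ⟨
  ℚ.toℚᵘ ((+ p) /' suc q) ℚᵘ.* ℚ.toℚᵘ (toℚ y)     ≈⟨ toℚᵘ-homo-* ((+ p) /' suc q) (toℚ y) ⟨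
  ℚ.toℚᵘ (((+ p) /' suc q) ℚ.* toℚ y)             ∎)
  where
  open ℚᵘP.≃-Reasoning
  cross : x ℤ.* + (suc q ℕ.* 1) ≡ + p ℤ.* y ℤ.* + 1
  cross = trans (cong (λ k → x ℤ.* + k) (ℕP.*-identityʳ (suc q)))
                (trans (ℤP.*-comm x (+ suc q)) (trans qx≡py (sym (ℤP.*-identityʳ (+ p ℤ.* y)))))

module Binomial where

  open import Data.Nat using (_+_; _*_)
  open import Data.Nat.Tactic.RingSolver using (solve-∀)
  open ℕP using (*-identityˡ; *-identityʳ; *-zeroʳ; *-comm; *-assoc; *-cancelˡ-≡; <-≤-trans; m≤m+n)
  open ≡-Reasoning

  [k+1]*[n+1]C[k+1]≡[n+1]*nCk : ∀ n k → suc k * (suc n C suc k) ≡ suc n * (n C k)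
  [k+1]*[n+1]C[k+1]≡[n+1]*nCk n zero = begin
    1 * (suc n C 1)  ≡⟨ *-identityˡ _ ⟩
    suc n C 1        ≡⟨ nC1≡n (suc n) ⟩
    suc n            ≡⟨ *-identityʳ (suc n) ⟨
    suc n * 1        ∎
  [k+1]*[n+1]C[k+1]≡[n+1]*nCk zero (suc k) = begin
    (2 + k) * (1 C (2 + k))  ≡⟨ cong ((2 + k) *_) (k>n⇒nCk≡0 {1} {2 + k} (s≤s (s≤s z≤n))) ⟩
    (2 + k) * 0              ≡⟨ *-zeroʳ (2 + k) ⟩
    0                        ≡⟨ cong (_+ 0) (k>n⇒nCk≡0 {0} {suc k} (s≤s z≤n)) ⟨
    1 * (0 C suc k)          ∎
  [k+1]*[n+1]C[k+1]≡[n+1]*nCk (suc n) (suc k) = begin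
    (2 + k) * ((2 + n) C (2 + k))
      ≡⟨ cong ((2 + k) *_) (nCk+nC[k+1]≡[n+1]C[k+1] (suc n) (suc k)) ⟨
    (2 + k) * (A + ((1 + n) C (2 + k)))
      ≡⟨ regroup k A ((1 + n) C (2 + k)) ⟩
    A + (1 + k) * A + (2 + k) * ((1 + n) C (2 + k))
      ≡⟨ cong₂ (λ x y → A + x + y) ([k+1]*[n+1]C[k+1]≡[n+1]*nCk n k)
                                   ([k+1]*[n+1]C[k+1]≡[n+1]*nCk n (suc k)) ⟩
    A + (1 + n) * (n C k) + (1 + n) * (n C suc k)
      ≡⟨ collect n A (n C k) (n C suc k) ⟩
    A + (1 + n) * ((n C k) + (n C suc k))
      ≡⟨ cong (λ x → A + (1 + n) * x) (nCk+nC[k+1]≡[n+1]C[k+1] n k) ⟩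
    A + (1 + n) * A
      ∎
    where
    A = suc n C suc k
    regroup : ∀ k a b → (2 + k) * (a + b) ≡ a + (1 + k) * a + (2 + k) * b
    regroup = solve-∀
    collect : ∀ n a x y → a + (1 + n) * x + (1 + n) * y ≡ a + (1 + n) * (x + y)
    collect = solve-∀

  nCk*kCj≡nCj*[n∸j]C[k∸j] : ∀ n k j → j ≤ k → (n C k) * (k C j) ≡ (n C j) * ((n ∸ j) C (k ∸ j))
  nCk*kCj≡nCj*[n∸j]C[k∸j] n k zero _ = *-comm (n C k) 1
  nCk*kCj≡nCj*[n∸j]C[k∸j] zero (suc k) (suc j) _ = begin
    (0 C suc k) * (suc k C suc j)  ≡⟨ cong (_* (suc k C suc j)) (k>n⇒nCk≡0 {0} {suc k} (s≤s z≤n)) ⟩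
    0                              ≡⟨ cong (_* (0 C (k ∸ j))) (k>n⇒nCk≡0 {0} {suc j} (s≤s z≤n)) ⟨
    (0 C suc j) * (0 C (k ∸ j))    ∎
  nCk*kCj≡nCj*[n∸j]C[k∸j] (suc n) (suc k) (suc j) (s≤s j≤k) = *-cancelˡ-≡ _ _ (suc j) (begin
    suc j * ((suc n C suc k) * (suc k C suc j))      ≡⟨ x*[y*z]≡y*[x*z] (suc j) (suc n C suc k) _ ⟩
    (suc n C suc k) * (suc j * (suc k C suc j))      ≡⟨ cong ((suc n C suc k) *_) ([k+1]*[n+1]C[k+1]≡[n+1]*nCk k j) ⟩
    (suc n C suc k) * (suc k * (k C j))              ≡⟨ x*[y*z]≡[y*x]*z (suc n C suc k) (suc k) (k C j) ⟩
    suc k * (suc n C suc k) * (k C j)                ≡⟨ cong (_* (k C j)) ([k+1]*[n+1]C[k+1]≡[n+1]*nCk n k) ⟩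
    suc n * (n C k) * (k C j)                        ≡⟨ *-assoc (suc n) (n C k) (k C j) ⟩
    suc n * ((n C k) * (k C j))                      ≡⟨ cong (suc n *_) (nCk*kCj≡nCj*[n∸j]C[k∸j] n k j j≤k) ⟩
    suc n * ((n C j) * ((n ∸ j) C (k ∸ j)))          ≡⟨ *-assoc (suc n) (n C j) _ ⟨
    suc n * (n C j) * ((n ∸ j) C (k ∸ j))            ≡⟨ cong (_* ((n ∸ j) C (k ∸ j))) ([k+1]*[n+1]C[k+1]≡[n+1]*nCk n j) ⟨
    suc j * (suc n C suc j) * ((n ∸ j) C (k ∸ j))    ≡⟨ *-assoc (suc j) (suc n C suc j) _ ⟩
    suc j * ((suc n C suc j) * ((n ∸ j) C (k ∸ j)))  ∎)
    where
    x*[y*z]≡y*[x*z] : ∀ x y z → x * (y * z) ≡ y * (x * z)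
    x*[y*z]≡y*[x*z] = solve-∀
    x*[y*z]≡[y*x]*z : ∀ x y z → x * (y * z) ≡ (y * x) * z
    x*[y*z]≡[y*x]*z = solve-∀

  nCk>0 : ∀ {n k} → k ≤ n → n C k > 0
  nCk>0 {n}     {zero}  _         = s≤s z≤n
  nCk>0 {suc n} {suc k} (s≤s k≤n) =
    subst (_> 0) (nCk+nC[k+1]≡[n+1]C[k+1] n k) (<-≤-trans (nCk>0 k≤n) (m≤m+n (n C k) (n C suc k)))

module Determinants where

  open import Data.Integer using (_+_; _*_; _-_)
  open import Data.Integer.Tactic.RingSolver using (solve-∀)
  open import Algebra.Properties.Semiring.Sum ℤP.+-*-semiring
  open ≡-Reasoning

  sumℤ≡sum : ∀ n (f : Fin n → ℤ) → sumℤ n f ≡ sum f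
  sumℤ≡sum zero    f = refl
  sumℤ≡sum (suc n) f = cong (_+_ (f zero)) (sumℤ≡sum n (f ∘ suc))

  -‿sum : ∀ {n} (f : Fin n → ℤ) → - sum f ≡ ∑[ i < n ] (- f i)
  -‿sum {n} f = begin
    - sum f                 ≡⟨ ℤP.-1*i≡-i (sum f) ⟨
    -1ℤ * sum f             ≡⟨ *-distribˡ-sum -1ℤ f ⟩
    ∑[ i < n ] (-1ℤ * f i)  ≡⟨ sum-cong-≗ (ℤP.-1*i≡-i ∘ f) ⟩
    ∑[ i < n ] (- f i)      ∎

  ∑∑-antisymmetric≡0 : ∀ {n} (G : Fin n → Fin n → ℤ) → (∀ i j → G j i ≡ - G i j) →
                       ∑[ i < n ] ∑[ j < n ] G i j ≡ + 0
  ∑∑-antisymmetric≡0 {n} G antisym = self-negative⇒0 S≡-S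
    where
    S = ∑[ i < n ] ∑[ j < n ] G i j
    S≡-S : S ≡ - S
    S≡-S = begin
      S                                  ≡⟨ ∑-comm G ⟩
      ∑[ j < n ] ∑[ i < n ] G i j        ≡⟨ sum-cong-≗ (λ j → sum-cong-≗ (antisym j)) ⟩
      ∑[ j < n ] ∑[ i < n ] (- G j i)    ≡⟨ sum-cong-≗ (λ j → -‿sum (G j)) ⟨
      ∑[ j < n ] (- ∑[ i < n ] G j i)    ≡⟨ -‿sum (λ j → ∑[ i < n ] G j i) ⟨
      - S                                ∎
    self-negative⇒0 : ∀ {x} → x ≡ - x → x ≡ + 0
    self-negative⇒0 {+ zero}    _  = refl
    self-negative⇒0 {+ suc _}   ()
    self-negative⇒0 { -[1+ _ ]} ()

  -- det (suc n) M inspects only M zero and the rows M (suc r), so it is definitionally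
  -- det (suc n) (M zero ∷ M ∘ suc): this is how the lemmas about u ∷ R apply to arbitrary matrices.
  Matrix : ℕ → Set
  Matrix n = Vector (Vector ℤ n) n

  minor : ∀ {n} → Matrix (suc n) → Fin (suc n) → Matrix n
  minor M k r s = M (suc r) (punchIn k s)

  laplace-term : ∀ {n} → Matrix (suc n) → Fin (suc n) → ℤ
  laplace-term {n} M k = sgn (toℕ k) * M zero k * det n (minor M k)

  laplace : ∀ {n} (M : Matrix (suc n)) → det (suc n) M ≡ sum (laplace-term M)
  laplace {n} M = sumℤ≡sum (suc n) (laplace-term M)

  laplace-scale : ∀ {n} (M N : Matrix (suc n)) (c : ℤ) →
                  (∀ k → M zero k * det n (minor M k) ≡ c * (N zero k * det n (minor N k))) →
                  det (suc n) M ≡ c * det (suc n) N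
  laplace-scale {n} M N c eq = begin
    det (suc n) M                              ≡⟨ laplace M ⟩
    sum (laplace-term M)                       ≡⟨ sum-cong-≗ term ⟩
    ∑[ k < suc n ] (c * laplace-term N k)      ≡⟨ *-distribˡ-sum c (laplace-term N) ⟨
    c * sum (laplace-term N)                   ≡⟨ cong (c *_) (laplace N) ⟨
    c * det (suc n) N                          ∎
    where
    term : ∀ k → laplace-term M k ≡ c * laplace-term N k
    term k = begin
      sgn (toℕ k) * M zero k * det n (minor M k)          ≡⟨ ℤP.*-assoc (sgn (toℕ k)) _ _ ⟩
      sgn (toℕ k) * (M zero k * det n (minor M k))        ≡⟨ cong (sgn (toℕ k) *_) (eq k) ⟩
      sgn (toℕ k) * (c * (N zero k * det n (minor N k)))  ≡⟨ rearrange (sgn (toℕ k)) c (N zero k) _ ⟩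
      c * (sgn (toℕ k) * N zero k * det n (minor N k))    ∎
      where
      rearrange : ∀ g c x d → g * (c * (x * d)) ≡ c * (g * x * d)
      rearrange = solve-∀

  laplace-cong : ∀ {n} (M N : Matrix (suc n)) →
                 (∀ k → M zero k * det n (minor M k) ≡ N zero k * det n (minor N k)) →
                 det (suc n) M ≡ det (suc n) N
  laplace-cong M N eq =
    trans (laplace-scale M N (+ 1) (λ k → trans (eq k) (sym (ℤP.*-identityˡ _)))) (ℤP.*-identityˡ _)

  det-cong : ∀ n {M N : Matrix n} → (∀ r s → M r s ≡ N r s) → det n M ≡ det n N
  det-cong zero    eq = refl
  det-cong (suc n) {M} {N} eq =
    laplace-cong M N (λ k → cong₂ _*_ (eq zero k) (det-cong n (λ r s → eq (suc r) (punchIn k s))))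

  det-scale-rows : ∀ n (a : Fin n → ℕ) (M : Matrix n) →
                   det n (λ r s → + a r * M r s) ≡ + prodℕ n a * det n M
  det-scale-rows zero    a M = refl
  det-scale-rows (suc n) a M = laplace-scale (λ r s → + a r * M r s) M (+ prodℕ (suc n) a) λ k → begin
    + a zero * M zero k * det n (λ r s → + a (suc r) * minor M k r s)
      ≡⟨ cong (+ a zero * M zero k *_) (det-scale-rows n (a ∘ suc) (minor M k)) ⟩
    + a zero * M zero k * (+ prodℕ n (a ∘ suc) * det n (minor M k))
      ≡⟨ rearrange (+ a zero) (M zero k) (+ prodℕ n (a ∘ suc)) (det n (minor M k)) ⟩
    + a zero * + prodℕ n (a ∘ suc) * (M zero k * det n (minor M k))
      ≡⟨ cong (_* (M zero k * det n (minor M k))) (ℤP.pos-* (a zero) (prodℕ n (a ∘ suc))) ⟨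
    + prodℕ (suc n) a * (M zero k * det n (minor M k))
      ∎
    where
    rearrange : ∀ x m p d → x * m * (p * d) ≡ x * p * (m * d)
    rearrange = solve-∀

  det-scale-columns : ∀ n (c : Fin n → ℕ) (M : Matrix n) →
                      det n (λ r s → M r s * + c s) ≡ + prodℕ n c * det n M
  det-scale-columns zero    c M = refl
  det-scale-columns (suc n) c M = laplace-scale (λ r s → M r s * + c s) M (+ prodℕ (suc n) c) λ k → begin
    M zero k * + c k * det n (λ r s → minor M k r s * + c (punchIn k s))
      ≡⟨ cong (M zero k * + c k *_) (det-scale-columns n (c ∘ punchIn k) (minor M k)) ⟩
    M zero k * + c k * (+ prodℕ n (c ∘ punchIn k) * det n (minor M k))
      ≡⟨ rearrange (+ c k) (M zero k) (+ prodℕ n (c ∘ punchIn k)) (det n (minor M k)) ⟩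
    + c k * + prodℕ n (c ∘ punchIn k) * (M zero k * det n (minor M k))
      ≡⟨ cong (_* (M zero k * det n (minor M k))) (extract k) ⟩
    + prodℕ (suc n) c * (M zero k * det n (minor M k))
      ∎
    where
    rearrange : ∀ x m p d → m * x * (p * d) ≡ x * p * (m * d)
    rearrange = solve-∀
    extract : ∀ k → + c k * + prodℕ n (c ∘ punchIn k) ≡ + prodℕ (suc n) c
    extract k = begin
      + c k * + prodℕ n (c ∘ punchIn k)          ≡⟨ ℤP.pos-* (c k) _ ⟨
      + (c k ℕ.* prodℕ n (c ∘ punchIn k))        ≡⟨ cong (λ p → + (c k ℕ.* p)) (prodℕ≡product n (c ∘ punchIn k)) ⟩
      + (c k ℕ.* Product.sum (c ∘ punchIn k))    ≡⟨ cong +_ (Product.sum-remove c) ⟨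
      + Product.sum c                            ≡⟨ cong +_ (prodℕ≡product (suc n) c) ⟨
      + prodℕ (suc n) c                          ∎

  det-first-column-sparse : ∀ n (M : Matrix (suc n)) → (∀ r → M (suc r) zero ≡ + 0) →
                            det (suc n) M ≡ M zero zero * det n (λ r s → M (suc r) (suc s))
  det-first-column-sparse n M column≡0 = begin
    det (suc n) M
      ≡⟨ laplace M ⟩
    + 1 * M zero zero * det n (minor M zero) + ∑[ k < n ] laplace-term M (suc k)
      ≡⟨ cong₂ _+_ (cong (_* det n (minor M zero)) (ℤP.*-identityˡ (M zero zero)))
                   (trans (sum-cong-≗ (term≡0 n M column≡0)) (sum-replicate-zero n)) ⟩
    M zero zero * det n (minor M zero) + + 0
      ≡⟨ ℤP.+-identityʳ _ ⟩
    M zero zero * det n (λ r s → M (suc r) (suc s))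
      ∎
    where
    term≡0 : ∀ n (M : Matrix (suc n)) → (∀ r → M (suc r) zero ≡ + 0) →
             ∀ k → laplace-term M (suc k) ≡ + 0
    term≡0 (suc n) M column≡0 k = begin
      a * det (suc n) (minor M (suc k))
        ≡⟨ cong (a *_) (det-first-column-sparse n (minor M (suc k)) (column≡0 ∘ suc)) ⟩
      a * (M (suc zero) zero * D)
        ≡⟨ cong (λ x → a * (x * D)) (column≡0 zero) ⟩
      a * (+ 0 * D)
        ≡⟨ ℤP.*-zeroʳ a ⟩
      + 0
        ∎
      where
      a = sgn (toℕ (suc k)) * M zero (suc k)
      D = det n (λ r s → minor M (suc k) (suc r) (suc s))

  det-linear-head : ∀ {n} (u v w : Vector ℤ (suc n)) (R : Vector (Vector ℤ (suc n)) n) (c : ℤ) →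
                    (∀ s → w s ≡ u s + c * v s) →
                    det (suc n) (w ∷ R) ≡ det (suc n) (u ∷ R) + c * det (suc n) (v ∷ R)
  det-linear-head {n} u v w R c w≡u+cv = begin
    det (suc n) (w ∷ R)
      ≡⟨ laplace (w ∷ R) ⟩
    ∑[ k < suc n ] (term w k)
      ≡⟨ sum-cong-≗ split ⟩
    ∑[ k < suc n ] (term u k + c * term v k)
      ≡⟨ ∑-distrib-+ (term u) (λ k → c * term v k) ⟩
    ∑[ k < suc n ] (term u k) + ∑[ k < suc n ] (c * term v k)
      ≡⟨ cong₂ _+_ (laplace (u ∷ R))
                   (trans (cong (c *_) (laplace (v ∷ R))) (*-distribˡ-sum c (term v))) ⟨
    det (suc n) (u ∷ R) + c * det (suc n) (v ∷ R)
      ∎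
    where
    term : Vector ℤ (suc n) → Fin (suc n) → ℤ
    term x k = sgn (toℕ k) * x k * det n (minor (w ∷ R) k)
    split : ∀ k → term w k ≡ term u k + c * term v k
    split k rewrite w≡u+cv k = distrib (sgn (toℕ k)) (u k) (v k) c (det n (minor (w ∷ R) k))
      where
      distrib : ∀ g x y c d → g * (x + c * y) * d ≡ g * x * d + c * (g * y * d)
      distrib = solve-∀

  sgn-suc : ∀ x → sgn (suc x) ≡ - sgn x
  sgn-suc zero          = refl
  sgn-suc (suc zero)    = refl
  sgn-suc (suc (suc x)) = sgn-suc x

  punchIn-punchOut-comm : ∀ {n} {i j : Fin (suc (suc n))} (i≢j : i ≢ j) (j≢i : j ≢ i) (s : Fin n) →
                          punchIn i (punchIn (punchOut i≢j) s) ≡ punchIn j (punchIn (punchOut j≢i) s)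
  punchIn-punchOut-comm {i = zero}  {zero}  i≢j _ s = contradiction refl i≢j
  punchIn-punchOut-comm {i = zero}  {suc j} _   _ s = refl
  punchIn-punchOut-comm {i = suc i} {zero}  _   _ s = refl
  punchIn-punchOut-comm {zero}  {suc zero} {suc zero} i≢j _ ()
  punchIn-punchOut-comm {suc n} {suc i} {suc j} _   _   zero    = refl
  punchIn-punchOut-comm {suc n} {suc i} {suc j} i≢j j≢i (suc s) =
    cong suc (punchIn-punchOut-comm (i≢j ∘ cong suc) (j≢i ∘ cong suc) s)

  punchOut-sign : ∀ {n} {i j : Fin (suc n)} → i ≢ j → ℤ
  punchOut-sign {i = i} i≢j = sgn (toℕ i) * sgn (toℕ (punchOut i≢j))

  punchOut-sign-antisym : ∀ {n} {i j : Fin (suc (suc n))} (i≢j : i ≢ j) (j≢i : j ≢ i) →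
                          punchOut-sign i≢j ≡ - punchOut-sign j≢i
  punchOut-sign-antisym {i = zero}  {zero}  i≢j _ = contradiction refl i≢j
  punchOut-sign-antisym {i = zero}  {suc j} _   _ rewrite sgn-suc (toℕ j) = lemma (sgn (toℕ j))
    where
    lemma : ∀ a → + 1 * a ≡ - (- a * + 1)
    lemma = solve-∀
  punchOut-sign-antisym {i = suc i} {zero}  _   _ rewrite sgn-suc (toℕ i) = lemma (sgn (toℕ i))
    where
    lemma : ∀ a → - a * + 1 ≡ - (+ 1 * a)
    lemma = solve-∀
  punchOut-sign-antisym {zero}  {suc zero} {suc zero} i≢j _ = contradiction refl i≢j
  punchOut-sign-antisym {suc n} {suc i} {suc j} i≢j j≢i = begin
    sgn (suc (toℕ i)) * sgn (suc (toℕ (punchOut i≢j′)))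
      ≡⟨ cong₂ _*_ (sgn-suc (toℕ i)) (sgn-suc (toℕ (punchOut i≢j′))) ⟩
    - sgn (toℕ i) * - sgn (toℕ (punchOut i≢j′))
      ≡⟨ neg*neg (sgn (toℕ i)) _ ⟩
    punchOut-sign i≢j′
      ≡⟨ punchOut-sign-antisym i≢j′ j≢i′ ⟩
    - punchOut-sign j≢i′
      ≡⟨ cong -_ (neg*neg (sgn (toℕ j)) _) ⟨
    - (- sgn (toℕ j) * - sgn (toℕ (punchOut j≢i′)))
      ≡⟨ cong -_ (cong₂ _*_ (sgn-suc (toℕ j)) (sgn-suc (toℕ (punchOut j≢i′)))) ⟨
    - (sgn (suc (toℕ j)) * sgn (suc (toℕ (punchOut j≢i′))))
      ∎
    where
    i≢j′ = i≢j ∘ cong suc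
    j≢i′ = j≢i ∘ cong suc
    neg*neg : ∀ a b → - a * - b ≡ a * b
    neg*neg = solve-∀

  det-repeated-head≡0 : ∀ {n} (u : Vector ℤ (suc (suc n))) (R : Vector (Vector ℤ (suc (suc n))) n) →
                        det (suc (suc n)) (u ∷ u ∷ R) ≡ + 0
  det-repeated-head≡0 {n} u R = begin
    det (suc (suc n)) M                                ≡⟨ laplace M ⟩
    sum (laplace-term M)                               ≡⟨ sum-cong-≗ expand ⟩
    ∑[ i < suc (suc n) ] ∑[ j < suc (suc n) ] G i j    ≡⟨ ∑∑-antisymmetric≡0 G G-antisym ⟩
    + 0                                                ∎
    where
    M = u ∷ u ∷ R

    D : Fin (suc (suc n)) → Fin (suc n) → ℤ
    D i l = det n (minor (minor M i) l)

    -- Expanding along rows 0 and 1, G i j is the term in which row 0 uses column i and row 1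
    -- uses column j; swapping i and j flips the sign and leaves the remaining minor unchanged.
    G : Fin (suc (suc n)) → Fin (suc (suc n)) → ℤ
    G i j with i Fin.≟ j
    ... | yes _  = + 0
    ... | no i≢j = punchOut-sign i≢j * (u i * u j) * D i (punchOut i≢j)

    G-diagonal : ∀ i → G i i ≡ + 0
    G-diagonal i with i Fin.≟ i
    ... | yes _  = refl
    ... | no i≢i = contradiction refl i≢i

    G-antisym : ∀ i j → G j i ≡ - G i j
    G-antisym i j with i Fin.≟ j | j Fin.≟ i
    ... | yes _   | yes _   = refl
    ... | yes i≡j | no j≢i  = contradiction (sym i≡j) j≢i
    ... | no i≢j  | yes j≡i = contradiction (sym j≡i) i≢j
    ... | no i≢j  | no j≢i  = begin
      punchOut-sign j≢i * (u j * u i) * D j (punchOut j≢i)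
        ≡⟨ cong (punchOut-sign j≢i * (u j * u i) *_) same-minor ⟩
      punchOut-sign j≢i * (u j * u i) * D i (punchOut i≢j)
        ≡⟨ cong (λ x → x * (u j * u i) * D i (punchOut i≢j)) (punchOut-sign-antisym j≢i i≢j) ⟩
      - punchOut-sign i≢j * (u j * u i) * D i (punchOut i≢j)
        ≡⟨ lemma (punchOut-sign i≢j) (u j) (u i) (D i (punchOut i≢j)) ⟩
      - (punchOut-sign i≢j * (u i * u j) * D i (punchOut i≢j))
        ∎
      where
      same-minor : D j (punchOut j≢i) ≡ D i (punchOut i≢j)
      same-minor = det-cong n (λ r s → cong (R r) (punchIn-punchOut-comm j≢i i≢j s))
      lemma : ∀ a x y d → - a * (x * y) * d ≡ - (a * (y * x) * d)
      lemma = solve-∀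

    G-punchIn : ∀ i l → G i (punchIn i l) ≡ sgn (toℕ i) * u i * (sgn (toℕ l) * u (punchIn i l) * D i l)
    G-punchIn i l with i Fin.≟ punchIn i l
    ... | yes i≡iₗ = contradiction (sym i≡iₗ) (FinP.punchInᵢ≢i i l)
    ... | no i≢iₗ  = begin
      sgn (toℕ i) * sgn (toℕ (punchOut i≢iₗ)) * (u i * u (punchIn i l)) * D i (punchOut i≢iₗ)
        ≡⟨ cong (λ o → sgn (toℕ i) * sgn (toℕ o) * (u i * u (punchIn i l)) * D i o)
                (trans (FinP.punchOut-cong i refl) (FinP.punchOut-punchIn i)) ⟩
      sgn (toℕ i) * sgn (toℕ l) * (u i * u (punchIn i l)) * D i l
        ≡⟨ lemma (sgn (toℕ i)) (sgn (toℕ l)) (u i) (u (punchIn i l)) (D i l) ⟩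
      sgn (toℕ i) * u i * (sgn (toℕ l) * u (punchIn i l) * D i l)
        ∎
      where
      lemma : ∀ a b x y d → a * b * (x * y) * d ≡ a * x * (b * y * d)
      lemma = solve-∀

    expand : ∀ i → laplace-term M i ≡ ∑[ j < suc (suc n) ] G i j
    expand i = begin
      sgn (toℕ i) * u i * det (suc n) (minor M i)
        ≡⟨ cong (sgn (toℕ i) * u i *_) (laplace (minor M i)) ⟩
      sgn (toℕ i) * u i * ∑[ l < suc n ] (sgn (toℕ l) * u (punchIn i l) * D i l)
        ≡⟨ *-distribˡ-sum (sgn (toℕ i) * u i) (laplace-term (minor M i)) ⟩
      ∑[ l < suc n ] (sgn (toℕ i) * u i * (sgn (toℕ l) * u (punchIn i l) * D i l))
        ≡⟨ sum-cong-≗ (G-punchIn i) ⟨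
      ∑[ l < suc n ] G i (punchIn i l)
        ≡⟨ ℤP.+-identityˡ _ ⟨
      + 0 + ∑[ l < suc n ] G i (punchIn i l)
        ≡⟨ cong (_+ ∑[ l < suc n ] G i (punchIn i l)) (G-diagonal i) ⟨
      G i i + ∑[ l < suc n ] G i (punchIn i l)
        ≡⟨ sum-remove (G i) ⟨
      ∑[ j < suc (suc n) ] G i j
        ∎

  det-add-head-multiple : ∀ {n} (u v w : Vector ℤ (suc (suc n))) (R : Vector (Vector ℤ (suc (suc n))) n)
                          (c : ℤ) → (∀ s → w s ≡ v s + c * u s) →
                          det (suc (suc n)) (u ∷ w ∷ R) ≡ det (suc (suc n)) (u ∷ v ∷ R)
  det-add-head-multiple {n} u v w R c w≡v+cu = begin
    det (suc (suc n)) (u ∷ w ∷ R)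
      ≡⟨ laplace (u ∷ w ∷ R) ⟩
    ∑[ k < suc (suc n) ] (term w k)
      ≡⟨ sum-cong-≗ split ⟩
    ∑[ k < suc (suc n) ] (term v k + c * term u k)
      ≡⟨ ∑-distrib-+ (term v) (λ k → c * term u k) ⟩
    ∑[ k < suc (suc n) ] (term v k) + ∑[ k < suc (suc n) ] (c * term u k)
      ≡⟨ cong₂ _+_ (laplace (u ∷ v ∷ R))
                   (trans (cong (c *_) (laplace (u ∷ u ∷ R))) (*-distribˡ-sum c (term u))) ⟨
    det (suc (suc n)) (u ∷ v ∷ R) + c * det (suc (suc n)) (u ∷ u ∷ R)
      ≡⟨ cong (λ x → det (suc (suc n)) (u ∷ v ∷ R) + c * x) (det-repeated-head≡0 u R) ⟩
    det (suc (suc n)) (u ∷ v ∷ R) + c * + 0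
      ≡⟨ trans (cong (_+_ (det (suc (suc n)) (u ∷ v ∷ R))) (ℤP.*-zeroʳ c)) (ℤP.+-identityʳ _) ⟩
    det (suc (suc n)) (u ∷ v ∷ R)
      ∎
    where
    term : Vector ℤ (suc (suc n)) → Fin (suc (suc n)) → ℤ
    term x k = sgn (toℕ k) * u k * det (suc n) (minor (u ∷ x ∷ R) k)
    split : ∀ k → term w k ≡ term v k + c * term u k
    split k = begin
      sgn (toℕ k) * u k * det (suc n) (minor (u ∷ w ∷ R) k)
        ≡⟨ cong (sgn (toℕ k) * u k *_)
                (det-linear-head (v ∘ punchIn k) (u ∘ punchIn k) (w ∘ punchIn k) (λ r → R r ∘ punchIn k) c
                                 (w≡v+cu ∘ punchIn k)) ⟩
      sgn (toℕ k) * u k * (det (suc n) (minor (u ∷ v ∷ R) k) + c * det (suc n) (minor (u ∷ u ∷ R) k))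
        ≡⟨ distrib (sgn (toℕ k) * u k) _ _ c ⟩
      term v k + c * term u k
        ∎
      where
      distrib : ∀ a x y c → a * (x + c * y) ≡ a * x + c * (a * y)
      distrib = solve-∀

  Δ : ∀ {n} → (ℕ → Vector ℤ n) → ℕ → Vector ℤ n
  Δ P zero    = P zero
  Δ P (suc x) = λ s → P (suc x) s - P x s

  -- Subtracting row 0 from row 1 undoes the first difference; the rows below row 0 are then
  -- the differences of P ∘ suc, so the induction hypothesis applies to every minor.
  det-Δ : ∀ n (P : ℕ → Vector ℤ n) → det n (λ r → Δ P (toℕ r)) ≡ det n (λ r → P (toℕ r))
  det-Δ zero          P = refl
  det-Δ (suc zero)    P = refl
  det-Δ (suc (suc n)) P = begin
    det (suc (suc n)) (λ r → Δ P (toℕ r))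
      ≡⟨ det-add-head-multiple (P 0) (P 1) (Δ P 1) lower -1ℤ
                               (λ s → cong (_+_ (P 1 s)) (sym (ℤP.-1*i≡-i (P 0 s)))) ⟩
    det (suc (suc n)) (P 0 ∷ P 1 ∷ lower)
      ≡⟨ laplace-cong (P 0 ∷ P 1 ∷ lower) (λ r → P (toℕ r))
                      (λ k → cong (P 0 k *_) (det-Δ (suc n) (λ x → P (suc x) ∘ punchIn k))) ⟩
    det (suc (suc n)) (λ r → P (toℕ r))
      ∎
    where
    lower : Vector (Vector ℤ (suc (suc n))) n
    lower r = Δ P (suc (suc (toℕ r)))

module BinomialDeterminants where

  open import Data.Integer using (_+_; _*_; _-_)
  open import Data.Integer.Tactic.RingSolver using (solve-∀)
  open Binomial
  open Determinants
  open ≡-Reasoning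

  pascal-difference : ∀ n {k} → k > 0 → + (suc n C k) - + (n C k) ≡ + (n C (k ∸ 1))
  pascal-difference n {suc k} _ = begin
    + (suc n C suc k) - + (n C suc k)            ≡⟨ cong (λ x → + x - + (n C suc k)) (nCk+nC[k+1]≡[n+1]C[k+1] n k) ⟨
    + ((n C k) ℕ.+ (n C suc k)) - + (n C suc k)  ≡⟨ cong (_- + (n C suc k)) (ℤP.pos-+ (n C k) (n C suc k)) ⟩
    + (n C k) + + (n C suc k) - + (n C suc k)    ≡⟨ x+y-y≡x (+ (n C k)) (+ (n C suc k)) ⟩
    + (n C k)                                    ∎
    where
    x+y-y≡x : ∀ x y → x + y - y ≡ x
    x+y-y≡x = solve-∀

  bdet-interval-drop-zero : ∀ e m (J : Fin (suc e) → ℕ) → J zero ≡ 0 → (∀ s → J (suc s) > 0) →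
                            bdet (suc e) (interval (suc e) m) J ≡ bdet e (interval e m) (λ s → J (suc s) ∸ 1)
  bdet-interval-drop-zero e m J J₀≡0 J>0 = begin
    bdet (suc e) (interval (suc e) m) J                       ≡⟨ det-Δ (suc e) P ⟨
    det (suc e) (λ r → Δ P (toℕ r))                           ≡⟨ det-first-column-sparse e (λ r → Δ P (toℕ r)) column≡0 ⟩
    Δ P 0 zero * det e (λ r s → Δ P (suc (toℕ r)) (suc s))    ≡⟨ cong₂ _*_ corner≡1 (det-cong e entry) ⟩
    + 1 * bdet e (interval e m) (λ s → J (suc s) ∸ 1)         ≡⟨ ℤP.*-identityˡ _ ⟩
    bdet e (interval e m) (λ s → J (suc s) ∸ 1)               ∎
    where
    P : ℕ → Vector ℤ (suc e)
    P x s = + ((m ℕ.+ x) C J s)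
    corner≡1 : Δ P 0 zero ≡ + 1
    corner≡1 = cong (λ k → + ((m ℕ.+ 0) C k)) J₀≡0
    column≡0 : ∀ r → Δ P (suc (toℕ r)) zero ≡ + 0
    column≡0 r = cong (λ k → + ((m ℕ.+ suc (toℕ r)) C k) - + ((m ℕ.+ toℕ r) C k)) J₀≡0
    entry : ∀ r s → Δ P (suc (toℕ r)) (suc s) ≡ + ((m ℕ.+ toℕ r) C (J (suc s) ∸ 1))
    entry r s rewrite ℕP.+-suc m (toℕ r) = pascal-difference (m ℕ.+ toℕ r) (J>0 s)

  bdet-interval-initial : ∀ e m (J : Fin e → ℕ) → (∀ r → J r ≡ toℕ r) → bdet e (interval e m) J ≡ + 1
  bdet-interval-initial zero    m J J≡toℕ = refl
  bdet-interval-initial (suc e) m J J≡toℕ = begin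
    bdet (suc e) (interval (suc e) m) J
      ≡⟨ bdet-interval-drop-zero e m J (J≡toℕ zero) (λ s → subst (_> 0) (sym (J≡toℕ (suc s))) (s≤s z≤n)) ⟩
    bdet e (interval e m) (λ s → J (suc s) ∸ 1)
      ≡⟨ bdet-interval-initial e m (λ s → J (suc s) ∸ 1) (λ s → cong (_∸ 1) (J≡toℕ (suc s))) ⟩
    + 1
      ∎

  head≤ : ∀ {e} (J : Fin (suc e) → ℕ) → (∀ s → J zero < J (suc s)) → ∀ s → J zero ≤ J s
  head≤ J J₀<J zero    = ℕP.≤-refl
  head≤ J J₀<J (suc s) = ℕP.<⇒≤ (J₀<J s)

  bdet-interval-factor : ∀ e i (J : Fin (suc e) → ℕ) → J zero ≤ i → (∀ s → J zero < J (suc s)) →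
    + prodℕ (suc e) (λ s → b (J s) (J zero)) * bdet (suc e) (interval (suc e) i) J
      ≡ + prodℕ (suc e) (λ r → b (interval (suc e) i r) (J zero))
        * bdet e (interval e (i ∸ J zero)) (λ s → J (suc s) ∸ J zero ∸ 1)
  bdet-interval-factor e i J J₀≤i J₀<J = begin
    + prodℕ (suc e) (λ s → J s C j) * bdet (suc e) (interval (suc e) i) J
      ≡⟨ det-scale-columns (suc e) (λ s → J s C j) (λ r s → + ((i ℕ.+ toℕ r) C J s)) ⟨
    det (suc e) (λ r s → + ((i ℕ.+ toℕ r) C J s) * + (J s C j))
      ≡⟨ det-cong (suc e) entry ⟩
    det (suc e) (λ r s → + ((i ℕ.+ toℕ r) C j) * + ((m ℕ.+ toℕ r) C K s))
      ≡⟨ det-scale-rows (suc e) (λ r → (i ℕ.+ toℕ r) C j) (λ r s → + ((m ℕ.+ toℕ r) C K s)) ⟩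
    + prodℕ (suc e) (λ r → (i ℕ.+ toℕ r) C j) * bdet (suc e) (interval (suc e) m) K
      ≡⟨ cong (+ prodℕ (suc e) (λ r → (i ℕ.+ toℕ r) C j) *_)
              (bdet-interval-drop-zero e m K (ℕP.n∸n≡0 j) (ℕP.m<n⇒0<n∸m ∘ J₀<J)) ⟩
    + prodℕ (suc e) (λ r → (i ℕ.+ toℕ r) C j) * bdet e (interval e m) (λ s → K (suc s) ∸ 1)
      ∎
    where
    j = J zero
    m = i ∸ j
    K : Fin (suc e) → ℕ
    K s = J s ∸ j
    entry : ∀ r s → + ((i ℕ.+ toℕ r) C J s) * + (J s C j) ≡ + ((i ℕ.+ toℕ r) C j) * + ((m ℕ.+ toℕ r) C K s)
    entry r s = begin
      + (n C J s) * + (J s C j)              ≡⟨ ℤP.pos-* (n C J s) (J s C j) ⟨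
      + ((n C J s) ℕ.* (J s C j))            ≡⟨ cong +_ (nCk*kCj≡nCj*[n∸j]C[k∸j] n (J s) j (head≤ J J₀<J s)) ⟩
      + ((n C j) ℕ.* ((n ∸ j) C K s))        ≡⟨ cong (λ x → + ((n C j) ℕ.* (x C K s))) (ℕP.+-∸-comm (toℕ r) J₀≤i) ⟩
      + ((n C j) ℕ.* ((m ℕ.+ toℕ r) C K s))  ≡⟨ ℤP.pos-* (n C j) ((m ℕ.+ toℕ r) C K s) ⟩
      + (n C j) * + ((m ℕ.+ toℕ r) C K s)    ∎
      where
      n = i ℕ.+ toℕ r

open Binomial using (nCk>0)
open BinomialDeterminants using (bdet-interval-drop-zero; bdet-interval-initial; bdet-interval-factor; head≤)
open import Data.Rational using (_*_; 1ℚ)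

lemma4p3 : (e i : ℕ) (J : Fin (suc e) → ℕ)
  → (∀ (r s : Fin (suc e)) → r Fin.< s → J r < J s)
  → (∀ (r : Fin (suc e)) → J r ≤ interval (suc e) i r)
  → (toℚ (bdet (suc e) (interval (suc e) i) J)
        ≡ piIJ e (interval (suc e) i) J
          * toℚ (bdet e (interval e (i ∸ J zero)) (λ r → J (suc r) ∸ J zero ∸ 1)))
    × (J zero ≡ 0
        → bdet (suc e) (interval (suc e) i) J
          ≡ bdet e (interval e i) (λ r → J (suc r) ∸ 1))
    × ((∀ (r : Fin (suc e)) → J r ≡ toℕ r)
        → (bdet (suc e) (interval (suc e) i) J ≡ + 1)
          × (piIJ e (interval (suc e) i) J ≡ 1ℚ))
lemma4p3 e i J increasing J≤I =
    q*x≡p*y⇒x≡p/q*y _ _ _ _ (prodℕ-pos (suc e) _ (λ s → nCk>0 (head≤ J J₀<J s)))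
                            (bdet-interval-factor e i J J₀≤i J₀<J)
  , (λ J₀≡0 → bdet-interval-drop-zero e i J J₀≡0 (λ s → subst (_< J (suc s)) J₀≡0 (J₀<J s)))
  , (λ J≡toℕ → bdet-interval-initial (suc e) i J J≡toℕ
             , piIJ-head-zero e (interval (suc e) i) J (J≡toℕ zero))
  where
  J₀<J : ∀ s → J zero < J (suc s)
  J₀<J s = increasing zero (suc s) (s≤s z≤n)
  J₀≤i : J zero ≤ i
  J₀≤i = subst (J zero ≤_) (ℕP.+-identityʳ i) (J≤I zero)
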